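{- Let $G$ be a graph with convex balls. Then for every $k\ge 3$, $G$ contains no metric triangle of type $(k,k,k-1)$.
   Context: Graphs are simple, undirected, connected, with all cliques finite; $d$ is the graph distance, $I(a,b)=\{z:d(a,z)+d(z,b)=d(a,b)\}$; $G$ has convex balls if each ball contains every vertex on a shortest path between two of its vertices. Vertices $u,v,w$ form a metric triangle if $I(u,v)\cap I(u,w)=\{u\}$, $I(u,v)\cap I(v,w)=\{v\}$, $I(u,w)\cap I(v,w)=\{w\}$; it has type $(k_1,k_2,k_3)$ if its side lengths, in nonincreasing order, are $k_1\ge k_2\ge k_3$. -}

module Defs where

open import Data.Nat using (ℕ; zero; suc; _+_; _≤_; _≥_)
open import Data.Product using (Σ; ∃; _×_; _,_)
open import Data.List using (List; []; _∷_)
open import Data.List.Relation.Binary.Permutation.Propositional using (_↭_)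
open import Relation.Binary.PropositionalEquality using (_≡_; _≢_)
open import Relation.Nullary using (¬_)

data Walk {V : Set} (Adj : V → V → Set) : V → V → ℕ → Set where
  here : ∀ {u} → Walk Adj u u zero
  step : ∀ {u w v n} → Adj u w → Walk Adj w v n → Walk Adj u v (suc n)

record Graph : Set₁ where
  field
    V       : Set
    Adj     : V → V → Set
    symAdj  : ∀ {x y} → Adj x y → Adj y x
    irrefl  : ∀ {x} → ¬ Adj x x
    connected    : ∀ u v → ∃ λ n → Walk Adj u v n
    cliquesFinite : (f : ℕ → V) → ¬ (∀ i j → i ≢ j → Adj (f i) (f j))

  Dist : V → V → ℕ → Set
  Dist u v n = Walk Adj u v n × (∀ m → Walk Adj u v m → n ≤ m)

  Interval : V → V → V → Set
  Interval a b z = ∃ λ p → ∃ λ q → Dist a z p × Dist z b q × Dist a b (p + q)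

  InBall : V → ℕ → V → Set
  InBall x r y = ∃ λ n → Dist x y n × n ≤ r

  ConvexBalls : Set
  ConvexBalls = ∀ x r a b z → InBall x r a → InBall x r b → Interval a b z → InBall x r z

  MetricTriangle : V → V → V → Set
  MetricTriangle u v w =
      (∀ z → Interval u v z → Interval u w z → z ≡ u)
    × (∀ z → Interval u v z → Interval v w z → z ≡ v)
    × (∀ z → Interval u w z → Interval v w z → z ≡ w)

  MetricTriangleOfType : V → V → V → ℕ → ℕ → ℕ → Set
  MetricTriangleOfType u v w k₁ k₂ k₃ =
    MetricTriangle u v w ×
    (∃ λ a → ∃ λ b → ∃ λ c →
       Dist u v a × Dist v w b × Dist u w c ×
       k₁ ≥ k₂ × k₂ ≥ k₃ ×
       (a ∷ b ∷ c ∷ []) ↭ (k₁ ∷ k₂ ∷ k₃ ∷ []))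

module Submission where

open import Defs
open import Data.Nat using (ℕ; zero; suc; _+_; _∸_; _≤_; _<_; z≤n; s≤s)
open import Data.Nat.Properties
open import Data.Product using (∃; _×_; _,_; proj₁; proj₂)
open import Data.Sum using (_⊎_; inj₁; inj₂)
open import Data.Empty using (⊥; ⊥-elim)
open import Data.List using ([]; _∷_)
open import Data.List.Relation.Unary.Any using (here; there)
open import Data.List.Membership.Propositional using (_∈_)
open import Data.List.Relation.Binary.Permutation.Propositional using (_↭_; ↭-sym)
open import Data.List.Relation.Binary.Permutation.Propositional.Properties using (∈-resp-↭; drop-mid)
open import Relation.Binary.Definitions using (Tri; tri<; tri≈; tri>)
open import Relation.Binary.PropositionalEquality using (_≡_; _≢_; refl; sym; trans; subst)
open import Relation.Nullary using (¬_; yes; no)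
open import Relation.Nullary.Decidable using (¬¬-excluded-middle)

-- Let u be the apex of such a triangle: d(u,v) = d(u,w) = k+1 and d(v,w) = k.
-- Walking from v to w along a geodesic, we keep a neighbour q of u lying on
-- geodesics from u to v and from u to the current vertex x. When the next
-- vertex y is not reached through q, a neighbour c of u on a geodesic to y is
-- also on a geodesic to x (convexity of a ball around c), hence adjacent to q
-- (convexity of the ball B(x, d(x,u) - 1)), hence on a geodesic to v
-- (convexity of B(v,k)). At y = w the vertex q lies in I(u,v) ∩ I(u,w),
-- contradicting the triangle condition at u.

∈-[x,x] : ∀ {A : Set} {x y : A} → y ∈ x ∷ x ∷ [] → y ≡ x
∈-[x,x] (here y≡x) = y≡x
∈-[x,x] (there (here y≡x)) = y≡x

↭-[x,x] : ∀ {A : Set} {x a b : A} → a ∷ b ∷ [] ↭ x ∷ x ∷ [] → a ≡ x × b ≡ x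
↭-[x,x] p = ∈-[x,x] (∈-resp-↭ p (here refl)) , ∈-[x,x] (∈-resp-↭ p (there (here refl)))

↭-[x,x,y] : ∀ {A : Set} {x y a b c : A} → a ∷ b ∷ c ∷ [] ↭ x ∷ x ∷ y ∷ [] →
            (a ≡ y × b ≡ x × c ≡ x) ⊎ (b ≡ y × a ≡ x × c ≡ x) ⊎ (c ≡ y × a ≡ x × b ≡ x)
↭-[x,x,y] {x = x} {a = a} {b} {c} p with ∈-resp-↭ (↭-sym p) (there (there (here refl)))
... | here refl = inj₁ (refl , ↭-[x,x] (drop-mid [] (x ∷ x ∷ []) p))
... | there (here refl) = inj₂ (inj₁ (refl , ↭-[x,x] (drop-mid (a ∷ []) (x ∷ x ∷ []) p)))
... | there (there (here refl)) = inj₂ (inj₂ (refl , ↭-[x,x] (drop-mid (a ∷ b ∷ []) (x ∷ x ∷ []) p)))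

module Metric (G : Graph) where
  open Graph G

  _++ʷ_ : ∀ {a b c m n} → Walk Adj a b m → Walk Adj b c n → Walk Adj a c (m + n)
  here ++ʷ W = W
  step e P ++ʷ W = step e (P ++ʷ W)

  _∷ʳʷ_ : ∀ {a b c m} → Walk Adj a b m → Adj b c → Walk Adj a c (suc m)
  here ∷ʳʷ e = step e here
  step e′ W ∷ʳʷ e = step e′ (W ∷ʳʷ e)

  reverseʷ : ∀ {a b m} → Walk Adj a b m → Walk Adj b a m
  reverseʷ here = here
  reverseʷ (step e W) = reverseʷ W ∷ʳʷ symAdj e

  walk-0⇒≡ : ∀ {a b} → Walk Adj a b 0 → a ≡ b
  walk-0⇒≡ here = refl

  dist-minimal : ∀ {a b n m} → Dist a b n → Walk Adj a b m → n ≤ m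
  dist-minimal d W = proj₂ d _ W

  dist-unique : ∀ {a b n m} → Dist a b n → Dist a b m → n ≡ m
  dist-unique d e = ≤-antisym (dist-minimal d (proj₁ e)) (dist-minimal e (proj₁ d))

  dist-sym : ∀ {a b n} → Dist a b n → Dist b a n
  dist-sym (W , minimal) = reverseʷ W , λ m W′ → minimal m (reverseʷ W′)

  dist-refl : ∀ {a} → Dist a a 0
  dist-refl = here , λ _ _ → z≤n

  dist-0⇒≡ : ∀ {a b} → Dist a b 0 → a ≡ b
  dist-0⇒≡ (W , _) = walk-0⇒≡ W

  adj⇒dist-1 : ∀ {a b} → Adj a b → Dist a b 1
  adj⇒dist-1 {a} a~b = step a~b here , minimal
    where
      minimal : ∀ m → Walk Adj _ _ m → 1 ≤ m
      minimal zero W = ⊥-elim (irrefl (subst (Adj a) (sym (walk-0⇒≡ W)) a~b))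
      minimal (suc _) _ = s≤s z≤n

  nonadjacent⇒dist-2 : ∀ {a b} → a ≢ b → ¬ Adj a b → Walk Adj a b 2 → Dist a b 2
  nonadjacent⇒dist-2 {a} a≢b a≁b W = W , minimal
    where
      minimal : ∀ m → Walk Adj _ _ m → 2 ≤ m
      minimal zero W′ = ⊥-elim (a≢b (walk-0⇒≡ W′))
      minimal (suc zero) (step a~c W′) = ⊥-elim (a≁b (subst (Adj a) (walk-0⇒≡ W′) a~c))
      minimal (suc (suc _)) _ = s≤s (s≤s z≤n)

  neighbour-dist-≥ : ∀ {a b y n s} → Adj a b → Dist a y (suc n) → Dist b y s → n ≤ s
  neighbour-dist-≥ a~b day dby = ≤-pred (dist-minimal day (step a~b (proj₁ dby)))

  geodesic-prefix : ∀ {a b c i m} → Dist a c (i + m) → Walk Adj a b i → Walk Adj b c m → Dist a b i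
  geodesic-prefix {i = i} {m} dac P S = P , λ t P′ → +-cancelʳ-≤ m i t (dist-minimal dac (P′ ++ʷ S))

  geodesic-suffix : ∀ {a b c i m} → Dist a c (i + m) → Walk Adj a b i → Walk Adj b c m → Dist b c m
  geodesic-suffix {i = i} {m} dac P S = S , λ t S′ → +-cancelˡ-≤ i m t (dist-minimal dac (P ++ʷ S′))

  inBall⇒dist-≤ : ∀ {x r y t} → InBall x r y → Dist x y t → t ≤ r
  inBall⇒dist-≤ (_ , dxy , ≤r) dxy′ = subst (_≤ _) (dist-unique dxy dxy′) ≤r

  -- A shortest walk need not be computable, but its existence cannot be refuted.
  ¬¬-dist : ∀ a b → ¬ ¬ ∃ (Dist a b)
  ¬¬-dist a b no-dist = shorten (proj₁ (connected a b)) ≤-refl (proj₂ (connected a b))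
    where
      shorten : ∀ {n} bound → n ≤ bound → Walk Adj a b n → ⊥
      shorten zero n≤0 W = no-dist (_ , W , λ _ _ → ≤-trans n≤0 z≤n)
      shorten {n} (suc bound) n≤ W = ¬¬-excluded-middle {A = ∃ λ m → m < n × Walk Adj a b m} λ
        { (yes (_ , m<n , W′)) → shorten bound (≤-pred (≤-trans m<n n≤)) W′
        ; (no none) → no-dist (n , W , λ m W′ → ≮⇒≥ (λ m<n → none (m , m<n , W′))) }

  interval-sym : ∀ {a b z} → Interval a b z → Interval b a z
  interval-sym (p , q , daz , dzb , dab) =
    q , p , dist-sym dzb , dist-sym daz , subst (Dist _ _) (+-comm p q) (dist-sym dab)

  metricTriangle-swap : ∀ {u v w} → MetricTriangle u v w → MetricTriangle v u w
  metricTriangle-swap (at-u , at-v , at-w) =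
    (λ z i j → at-v z (interval-sym i) j) , (λ z i j → at-u z (interval-sym i) j) , λ z i j → at-w z j i

  metricTriangle-rotate : ∀ {u v w} → MetricTriangle u v w → MetricTriangle w u v
  metricTriangle-rotate (at-u , at-v , at-w) =
    (λ z i j → at-w z (interval-sym i) (interval-sym j)) ,
    (λ z i j → at-u z j (interval-sym i)) ,
    (λ z i j → at-v z j (interval-sym i))

module IsoscelesTriangle (G : Graph) (convex : Graph.ConvexBalls G)
  {u v w : Graph.V G} {k : ℕ} (2≤k : 2 ≤ k)
  (duv : Graph.Dist G u v (suc k)) (duw : Graph.Dist G u w (suc k)) (dvw : Graph.Dist G v w k)
  (triangle : Graph.MetricTriangle G u v w) where

  open Graph G
  open Metric G

  -- For a neighbour q of u this says q ∈ I(u,x).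
  Towards : V → V → Set
  Towards q x = ∃ λ m → Dist u x (suc m) × Dist q x m

  no-common-first-step : ∀ {q} → Adj u q → Dist q v k → Dist q w k → ⊥
  no-common-first-step {q} u~q dqv dqw = irrefl (subst (Adj u) q≡u u~q)
    where
      q≡u : q ≡ u
      q≡u = proj₁ triangle _ (1 , k , adj⇒dist-1 u~q , dqv , duv) (1 , k , adj⇒dist-1 u~q , dqw , duw)

  ¬towards⇒dist-> : ∀ {q y n s} → Adj u q → Dist u y (suc n) → Dist q y s → ¬ Towards q y → n < s
  ¬towards⇒dist-> u~q duy dqy ¬q→y = ≤∧≢⇒< (neighbour-dist-≥ u~q duy dqy) λ { refl → ¬q→y (_ , duy , dqy) }

  -- d(u,x) ≥ d(u,w) − d(x,w) = j + 1, and equality would put x in I(u,w) ∩ I(v,w).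
  geodesic-far-from-apex : ∀ {x j m mx} → j + suc m ≡ k →
                           Dist v x j → Dist x w (suc m) → Dist u x (suc mx) → 2 ≤ mx
  geodesic-far-from-apex {j = zero} _ dvx _ dux with dist-0⇒≡ dvx
  ... | refl = subst (2 ≤_) (suc-injective (dist-unique duv dux)) 2≤k
  geodesic-far-from-apex {x} {suc j} {m} {mx} eq dvx dxw dux with m≤n⇒m<n∨m≡n j<mx
    where
      j<mx : suc j ≤ mx
      j<mx = +-cancelʳ-≤ (suc m) (suc j) mx
        (≤-pred (subst (λ t → suc t ≤ suc mx + suc m) (sym eq) (dist-minimal duw (proj₁ dux ++ʷ proj₁ dxw))))
  ... | inj₁ j+1<mx = ≤-trans (s≤s (s≤s z≤n)) j+1<mx
  ... | inj₂ refl = ⊥-elim (1+n≢0 (dist-unique (subst (λ z → Dist z w (suc m)) x≡w dxw) dist-refl))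
    where
      x≡w : x ≡ w
      x≡w = proj₂ (proj₂ triangle) x
        (suc (suc j) , suc m , dux , dxw , subst (λ t → Dist u w (suc t)) (sym eq) duw)
        (suc j , suc m , dvx , dxw , subst (Dist v w) (sym eq) dvw)

  -- The case n = mx is the one needing convexity: then x ∈ I(q,y), and the ball
  -- B(c,n) contains q and y.
  towards-next⇒towards : ∀ {q c x y mx n} → Adj u q → Adj u c → Adj x y → 2 ≤ mx →
    Dist u x (suc mx) → Dist q x mx → Dist u y (suc n) → Dist c y n → ¬ Towards q y →
    ¬ ¬ Dist c x mx
  towards-next⇒towards {q} {c} {x} {y} {mx} {n} u~q u~c x~y 2≤mx dux dqx duy dcy ¬q→y ¬dcx =
    ¬¬-dist c x λ (_ , dcx) → ¬¬-dist q y λ (_ , dqy) → compare (<-cmp n mx) dcx dqy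
    where
      settle : ∀ {t} → Dist c x t → t ≤ mx → ⊥
      settle dcx t≤mx = ¬dcx (subst (Dist c x) (≤-antisym t≤mx (neighbour-dist-≥ u~c dux dcx)) dcx)

      n<dist[q,y] : ∀ {s} → Dist q y s → n < s
      n<dist[q,y] dqy = ¬towards⇒dist-> u~q duy dqy ¬q→y

      dist[q,y]≤1+mx : ∀ {s} → Dist q y s → s ≤ suc mx
      dist[q,y]≤1+mx dqy = dist-minimal dqy (proj₁ dqx ∷ʳʷ x~y)

      compare : ∀ {t s} → Tri (n < mx) (n ≡ mx) (mx < n) → Dist c x t → Dist q y s → ⊥
      compare (tri< n<mx _ _) dcx _ = settle dcx (≤-trans (dist-minimal dcx (proj₁ dcy ∷ʳʷ symAdj x~y)) n<mx)
      compare (tri≈ _ refl _) dcx dqy = ¬¬-dist c q λ (_ , dcq) → settle dcx (inBall⇒dist-≤ (x∈ball dcq) dcx)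
        where
          x∈I[q,y] : Interval q y x
          x∈I[q,y] = n , 1 , dqx , adj⇒dist-1 x~y ,
            subst (Dist q y) (trans (≤-antisym (dist[q,y]≤1+mx dqy) (n<dist[q,y] dqy)) (+-comm 1 n)) dqy
          x∈ball : ∀ {e} → Dist c q e → InBall c n x
          x∈ball dcq = convex c n q y x
            (_ , dcq , ≤-trans (dist-minimal dcq (step (symAdj u~c) (step u~q here))) 2≤mx)
            (n , dcy , ≤-refl) x∈I[q,y]
      compare (tri> _ _ mx<n) _ dqy = <⇒≱ (n<dist[q,y] dqy) (≤-trans (dist[q,y]≤1+mx dqy) mx<n)

  towards-both⇒adjacent : ∀ {q c x mx} → Adj u q → Adj u c → c ≢ q →
    Dist u x (suc mx) → Dist q x mx → Dist c x mx → ¬ ¬ Adj c q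
  towards-both⇒adjacent {q} {c} {x} {mx} u~q u~c c≢q dux dqx dcx c≁q =
    1+n≰n (inBall⇒dist-≤ u∈ball (dist-sym dux))
    where
      u∈I[c,q] : Interval c q u
      u∈I[c,q] = 1 , 1 , dist-sym (adj⇒dist-1 u~c) , adj⇒dist-1 u~q ,
        nonadjacent⇒dist-2 c≢q c≁q (step (symAdj u~c) (step u~q here))
      u∈ball : InBall x mx u
      u∈ball = convex x mx c q u (mx , dist-sym dcx , ≤-refl) (mx , dist-sym dqx , ≤-refl) u∈I[c,q]

  towards-base-transfer : ∀ {q c y n j} → Adj u q → Adj u c → Adj c q → Dist q v k →
    Dist v y j → j ≤ k → Dist u y (suc n) → Dist c y n → ¬ Towards q y → ¬ ¬ Dist c v k
  towards-base-transfer {q} {c} {y} {n} u~q u~c c~q dqv dvy j≤k duy dcy ¬q→y ¬dcv =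
    ¬¬-dist q y λ (_ , dqy) → ¬dcv (dist[c,v]≡k (c∈ball dqy))
    where
      c∈ball : ∀ {s} → Dist q y s → InBall v k c
      c∈ball dqy = convex v k q y c (k , dist-sym dqv , ≤-refl) (_ , dvy , j≤k)
        (1 , n , adj⇒dist-1 (symAdj c~q) , dcy ,
         subst (Dist q y) (≤-antisym (dist-minimal dqy (step (symAdj c~q) (proj₁ dcy)))
                                     (¬towards⇒dist-> u~q duy dqy ¬q→y)) dqy)
      dist[c,v]≡k : InBall v k c → Dist c v k
      dist[c,v]≡k (t , dvc , t≤k) =
        subst (Dist c v) (≤-antisym t≤k (neighbour-dist-≥ u~c duv (dist-sym dvc))) (dist-sym dvc)

  march : ∀ m j {x} → j + m ≡ k → Dist v x j → Walk Adj x w m →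
          ∀ {q} → Adj u q → Dist q v k → Towards q x → ⊥
  march zero _ _ _ here {q} u~q dqv (_ , duw′ , dqw) =
    no-common-first-step u~q dqv (subst (Dist q w) (suc-injective (dist-unique duw′ duw)) dqw)
  march (suc m) j {x} eq dvx (step {w = y} x~y W) {q} u~q dqv (mx , dux , dqx) =
    ¬¬-excluded-middle {A = Towards q y} λ
      { (yes q→y) → march m (suc j) eq′ dvy W u~q dqv q→y
      ; (no ¬q→y) → ¬¬-dist u y λ (_ , duy) → switch duy ¬q→y }
    where
      eq′ : suc j + m ≡ k
      eq′ = trans (sym (+-suc j m)) eq
      1+j≤k : suc j ≤ k
      1+j≤k = subst (suc j ≤_) eq′ (m≤m+n (suc j) m)
      dxw : Dist x w (suc m)
      dxw = geodesic-suffix (subst (Dist v w) (sym eq) dvw) (proj₁ dvx) (step x~y W)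
      dvy : Dist v y (suc j)
      dvy = geodesic-prefix (subst (Dist v w) (sym eq′) dvw) (proj₁ dvx ∷ʳʷ x~y) W
      switch : ∀ {F} → Dist u y F → ¬ Towards q y → ⊥
      switch {zero} duy _ =
        1+n≰n (subst (_≤ k) (dist-unique dvy dvy′) 1+j≤k)
        where
          dvy′ : Dist v y (suc k)
          dvy′ = subst (λ z → Dist v z (suc k)) (dist-0⇒≡ duy) (dist-sym duv)
      switch {suc n} (step {w = c} u~c Wcy , minimal) ¬q→y =
        towards-next⇒towards u~q u~c x~y (geodesic-far-from-apex eq dvx dxw dux)
          dux dqx duy dcy ¬q→y λ dcx →
        towards-both⇒adjacent u~q u~c c≢q dux dqx dcx λ c~q →
        towards-base-transfer u~q u~c c~q dqv dvy 1+j≤k duy dcy ¬q→y λ dcv →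
        march m (suc j) eq′ dvy W u~c dcv (n , duy , dcy)
        where
          duy : Dist u y (suc n)
          duy = step u~c Wcy , minimal
          dcy : Dist c y n
          dcy = geodesic-suffix duy (step u~c here) Wcy
          c≢q : c ≢ q
          c≢q refl = ¬q→y (n , duy , dcy)

  impossible : ⊥
  impossible = start (proj₁ duv)
    where
      start : Walk Adj u v (suc k) → ⊥
      start (step {w = q} u~q W) = march k 0 refl dist-refl (proj₁ dvw) u~q dqv (k , duv , dqv)
        where
          dqv : Dist q v k
          dqv = geodesic-suffix duv (step u~q here) W

lemma7p5 : (G : Graph) → Graph.ConvexBalls G →
    ∀ (k : ℕ) → 3 ≤ k →
    ∀ u v w → ¬ Graph.MetricTriangleOfType G u v w k k (k ∸ 1)
lemma7p5 G convex (suc k) (s≤s 2≤k) u v w (triangle , _ , _ , _ , duv , dvw , duw , _ , _ , sides)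
  with ↭-[x,x,y] sides
... | inj₁ (refl , refl , refl) =
  IsoscelesTriangle.impossible G convex 2≤k (dist-sym duw) (dist-sym dvw) duv (metricTriangle-rotate triangle)
  where open Metric G
... | inj₂ (inj₁ (refl , refl , refl)) =
  IsoscelesTriangle.impossible G convex 2≤k duv duw dvw triangle
... | inj₂ (inj₂ (refl , refl , refl)) =
  IsoscelesTriangle.impossible G convex 2≤k (dist-sym duv) dvw duw (metricTriangle-swap triangle)
  where open Metric G
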